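{- For every positive integer $N$ there exist a set $V\subset\mathbb{R}$ with $|V|=2^N$ and a graph $G=(V,E)$ with $|E|=N2^{N-1}$ such that no subset of $V$ of size greater than $2$ is reconstructible from $G$.
   Context: Given a finite set $V\subset\mathbb{R}$ and a graph $G$ on vertex set $V$, a subset $V'\subseteq V$ is reconstructible from $G$ if for every injective map $g:V\to\mathbb{R}$ with $|g(x)-g(y)|=|x-y|$ for every edge $xy$ of $G$, we have $|g(u)-g(v)|=|u-v|$ for all $u,v\in V'$. -}

module Defs where

open import Data.Nat using (ℕ; _<_)
open import Data.Fin using (Fin)
open import Data.Fin.Subset using (Subset; _∈_)
open import Data.Rational using (ℚ; _-_; ∣_∣)
open import Data.List using (List)
open import Data.List.Relation.Unary.Unique.Propositional using (Unique)
import Data.List.Membership.Propositional as LM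
open import Data.List.Relation.Unary.All using (All)
open import Data.Product using (_×_; _,_)
open import Relation.Binary.PropositionalEquality using (_≡_)
open import Function.Definitions using (Injective)

-- Distance on ℚ (stand-in for ℝ).
dist : ℚ → ℚ → ℚ
dist x y = ∣ x - y ∣

-- A finite set V ⊂ ℚ with |V| = n is given by an injective labelling
-- v : Fin n → ℚ (V = image of v).  A map g : V → ℚ is given by its values
-- on the labels, g : Fin n → ℚ; it is injective on V iff injective on labels.

SimpleEdges : {n : ℕ} → List (Fin n × Fin n) → Set
SimpleEdges E = All (λ e → Data.Fin._<_ (Data.Product.proj₁ e) (Data.Product.proj₂ e)) E × Unique E
  where import Data.Fin
        import Data.Product

EdgePreserving : {n : ℕ} → (v : Fin n → ℚ) → List (Fin n × Fin n) → (Fin n → ℚ) → Set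
EdgePreserving v E g = ∀ {i j} → (i , j) LM.∈ E → dist (g i) (g j) ≡ dist (v i) (v j)

Reconstructible : {n : ℕ} → (v : Fin n → ℚ) → List (Fin n × Fin n) → Subset n → Set
Reconstructible {n} v E V' =
  (g : Fin n → ℚ) → Injective _≡_ _≡_ g → EdgePreserving v E g →
  ∀ {u w} → u ∈ V' → w ∈ V' → dist (g u) (g w) ≡ dist (v u) (v w)

-- Take V = {0, 1, …, 2^N − 1} and let G be the N-dimensional hypercube on the binary expansions,
-- so every edge joins some u and u + 2^k where bit k of u is 0. Flipping a fixed bit j of every
-- label is an injective relabelling that keeps every edge length: edges along bit j are reversed,
-- all other edges are translated by ±2^j. Given three distinct vertices, take the most
-- significant bit on which they do not all agree: two of them, x and y, share it and the third,
-- z, does not. Flipping that bit keeps |x − z| only if x and z agree on all lower bits, and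
-- likewise for y and z; but then x = y. So no three vertices keep their mutual distances under
-- all the flips.
module Submission where

open import Defs
open import Data.Nat using (ℕ; _<_; _≤_; _*_; _^_; _∸_)
open import Data.Fin using (Fin)
open import Data.Fin.Subset using (Subset; ∣_∣)
open import Data.Rational using (ℚ)
open import Data.List using (List; length)
open import Data.Product using (Σ; _×_)
open import Relation.Binary.PropositionalEquality using (_≡_)
open import Relation.Nullary using (¬_)
open import Function.Definitions using (Injective)

open import Algebra.Definitions using (Involutive)
open import Data.Empty using (⊥; ⊥-elim)
open import Data.Fin as Fin using (zero; suc; toℕ; combine; remQuot; opposite; lift)
open import Data.Fin.Patterns using (0F; 1F; 2F)
open import Data.Fin.Properties
  using (toℕ-injective; toℕ<n; toℕ-↑ˡ; toℕ-↑ʳ; toℕ-combine; remQuot-combine; combine-surjective;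
         combine-injective; combine-injectiveˡ; combine-injectiveʳ; combine-monoˡ-<;
         opposite-involutive; suc-injective; lift-injective)
import Data.Fin.Subset as Subset
open import Data.Integer as ℤ using (_⊖_)
import Data.Integer.Properties as ℤ
open import Data.List using ([]; _∷_; _++_; map; allFin; cartesianProductWith)
open import Data.List.Membership.Propositional using (_∈_)
open import Data.List.Membership.Propositional.Properties using (∈-++⁻; ∈-map⁻; ∈-cartesianProductWith⁻)
open import Data.List.Properties using (length-++; length-map; length-tabulate)
open import Data.List.Relation.Unary.All as All using (All)
open import Data.List.Relation.Unary.Unique.Propositional using (Unique)
open import Data.List.Relation.Unary.AllPairs using ([])
open import Data.List.Relation.Binary.Disjoint.Propositional using (Disjoint)
import Data.List.Relation.Unary.Unique.Propositional.Properties as Unique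
open import Data.Nat as ℕ using (zero; suc; _+_; ∣_-_∣; ⌊_/2⌋; s≤s)
open import Data.Nat.Properties
  using (≤-total; <⇒≤; ≤-trans; m≤m+n; +-assoc; +-comm; +-cancelˡ-≡; +-monoʳ-<; m∸n+n≡m;
         m≤n⇒∣m-n∣≡n∸m; m≤n⇒∣n-m∣≡n∸m; ∣-∣-comm; ∣m-m+n∣≡n; ∣m+n-m+o∣≡∣n-o∣; n≡⌊n+n/2⌋;
         +-commutativeSemigroup)
open import Algebra.Properties.CommutativeSemigroup +-commutativeSemigroup using (xy∙z≈xz∙y)
open import Data.Nat.Tactic.RingSolver using (solve-∀)
open import Data.Product using (_,_; proj₁; proj₂; uncurry)
open import Data.Rational as ℚ using (toℚᵘ)
open import Data.Rational.Literals using (fromℤ)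
open import Data.Rational.Properties using (toℚᵘ-injective; toℚᵘ-homo-+; toℚᵘ-homo‿-; toℚᵘ-homo-∣-∣)
open import Data.Rational.Unnormalised as ℚᵘ using (mkℚᵘ; *≡*)
import Data.Rational.Unnormalised.Properties as ℚᵘ
open import Data.Sum using (inj₁; inj₂)
open import Data.Vec using (_∷_; here; there)
open import Function using (id; _∘_; _⇔_; mk⇔; Equivalence)
open import Relation.Binary.PropositionalEquality using (_≢_; refl; sym; trans; cong; cong₂; subst₂; module ≡-Reasoning)

private
  variable
    A B C : Set

∣m⊖n∣≡∣m-n∣ : ∀ m n → ℤ.∣ m ⊖ n ∣ ≡ ∣ m - n ∣
∣m⊖n∣≡∣m-n∣ m n with ≤-total m n
... | inj₁ m≤n = trans (ℤ.∣⊖∣-≤ m≤n) (sym (m≤n⇒∣m-n∣≡n∸m m≤n))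
... | inj₂ n≤m = trans (ℤ.∣m⊖n∣≡∣n⊖m∣ m n) (trans (ℤ.∣⊖∣-≤ n≤m) (sym (m≤n⇒∣n-m∣≡n∸m n≤m)))

fromℕ : ℕ → ℚ
fromℕ n = fromℤ (ℤ.+ n)

fromℕ-injective : Injective _≡_ _≡_ fromℕ
fromℕ-injective = ℤ.+-injective ∘ cong ℚ.numerator

dist-fromℕ : ∀ m n → dist (fromℕ m) (fromℕ n) ≡ fromℕ ∣ m - n ∣
dist-fromℕ m n = toℚᵘ-injective (begin
  toℚᵘ ℚ.∣ fromℕ m ℚ.- fromℕ n ∣               ≈⟨ toℚᵘ-homo-∣-∣ (fromℕ m ℚ.- fromℕ n) ⟩
  ℚᵘ.∣ toℚᵘ (fromℕ m ℚ.+ ℚ.- fromℕ n) ∣        ≈⟨ ℚᵘ.∣-∣-cong toℚᵘ-difference ⟩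
  ℚᵘ.∣ mkℚᵘ (ℤ.+ m) 0 ℚᵘ.- mkℚᵘ (ℤ.+ n) 0 ∣    ≈⟨ *≡* (cong (ℤ._* ℤ.1ℤ) (cong ℤ.+_ ∣difference∣)) ⟩
  mkℚᵘ (ℤ.+ ∣ m - n ∣) 0                       ∎)
  where
  open ℚᵘ.≃-Reasoning
  toℚᵘ-difference : toℚᵘ (fromℕ m ℚ.+ ℚ.- fromℕ n) ℚᵘ.≃ mkℚᵘ (ℤ.+ m) 0 ℚᵘ.- mkℚᵘ (ℤ.+ n) 0
  toℚᵘ-difference = ℚᵘ.≃-trans (toℚᵘ-homo-+ (fromℕ m) (ℚ.- fromℕ n)) (ℚᵘ.+-congʳ (mkℚᵘ (ℤ.+ m) 0) (toℚᵘ-homo‿- (fromℕ n)))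
  ∣difference∣ : ℤ.∣ ℤ.+ m ℤ.* ℤ.1ℤ ℤ.+ ℤ.- ℤ.+ n ℤ.* ℤ.1ℤ ∣ ≡ ∣ m - n ∣
  ∣difference∣ = trans (cong ℤ.∣_∣ (trans (cong₂ ℤ._+_ (ℤ.*-identityʳ (ℤ.+ m)) (ℤ.*-identityʳ (ℤ.- ℤ.+ n)))
                                          (ℤ.[+m]-[+n]≡m⊖n m n)))
                       (∣m⊖n∣≡∣m-n∣ m n)

m+m≡n+n⇒m≡n : ∀ {m n} → m + m ≡ n + n → m ≡ n
m+m≡n+n⇒m≡n {m} {n} eq = trans (n≡⌊n+n/2⌋ m) (trans (cong ⌊_/2⌋ eq) (sym (n≡⌊n+n/2⌋ n)))

∣n+m-o∣≡∣n+o-m∣⇒m≡o : ∀ {m n o} → m ≤ n → o ≤ n → ∣ n + m - o ∣ ≡ ∣ n + o - m ∣ → m ≡ o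
∣n+m-o∣≡∣n+o-m∣⇒m≡o {m} {n} {o} m≤n o≤n eq = m+m≡n+n⇒m≡n (+-cancelˡ-≡ d _ _ (begin
  d + (m + m)  ≡⟨ +-assoc d m m ⟨
  d + m + m    ≡⟨ cong (_+ m) d+m≡n+o ⟩
  n + o + m    ≡⟨ xy∙z≈xz∙y n o m ⟩
  n + m + o    ≡⟨ cong (_+ o) d+o≡n+m ⟨
  d + o + o    ≡⟨ +-assoc d o o ⟩
  d + (o + o)  ∎))
  where
  open ≡-Reasoning
  ∣k-l∣+l≡k : ∀ {k l} → l ≤ k → ∣ k - l ∣ + l ≡ k
  ∣k-l∣+l≡k l≤k = trans (cong (_+ _) (m≤n⇒∣n-m∣≡n∸m l≤k)) (m∸n+n≡m l≤k)
  d : ℕ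
  d = ∣ n + m - o ∣
  d+o≡n+m : d + o ≡ n + m
  d+o≡n+m = ∣k-l∣+l≡k (≤-trans o≤n (m≤m+n n m))
  d+m≡n+o : d + m ≡ n + o
  d+m≡n+o = trans (cong (_+ m) eq) (∣k-l∣+l≡k (≤-trans m≤n (m≤m+n n o)))

enumerate : ∀ {n k} (p : Subset n) → k ≤ ∣ p ∣ →
            Σ (Fin k → Fin n) λ f → Injective _≡_ _≡_ f × (∀ i → f i Subset.∈ p)
enumerate {k = zero} p _ = (λ ()) , (λ { {()} }) , λ ()
enumerate (Subset.outside ∷ p) k≤∣p∣ with enumerate p k≤∣p∣
... | f , f-injective , f∈p = suc ∘ f , f-injective ∘ suc-injective , there ∘ f∈p
enumerate {k = suc k} (Subset.inside ∷ p) (s≤s k≤∣p∣) with enumerate p k≤∣p∣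
... | f , f-injective , f∈p = lift 1 f , lift-injective f f-injective 1 , λ { zero → here ; (suc i) → there (f∈p i) }

length-cartesianProductWith : ∀ (f : A → B → C) xs ys →
                              length (cartesianProductWith f xs ys) ≡ length xs * length ys
length-cartesianProductWith f []       ys = refl
length-cartesianProductWith f (x ∷ xs) ys =
  trans (length-++ (map (f x) ys)) (cong₂ _+_ (length-map (f x) ys) (length-cartesianProductWith f xs ys))

distℕ : ∀ {n} → Fin n → Fin n → ℕ
distℕ x y = ∣ toℕ x - toℕ y ∣

PreservesDist : ∀ {n} → (Fin n → Fin n) → Fin n → Fin n → Set
PreservesDist σ x y = distℕ (σ x) (σ y) ≡ distℕ x y

label : ∀ {n} → Fin n → ℚ
label = fromℕ ∘ toℕ

label-injective : ∀ {n} → Injective _≡_ _≡_ (label {n})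
label-injective = toℕ-injective ∘ fromℕ-injective

reconstructible⇒preserved : ∀ {n} {E : List (Fin n × Fin n)} {V'} → Reconstructible label E V' →
  (σ : Fin n → Fin n) → Injective _≡_ _≡_ σ → (∀ {x y} → (x , y) ∈ E → PreservesDist σ x y) →
  ∀ {u w} → u Subset.∈ V' → w Subset.∈ V' → PreservesDist σ u w
reconstructible⇒preserved R σ σ-injective σ-preserves {u} {w} u∈V' w∈V' = fromℕ-injective (begin
  fromℕ (distℕ (σ u) (σ w))        ≡⟨ dist-label (σ u) (σ w) ⟨
  dist (label (σ u)) (label (σ w)) ≡⟨ R (label ∘ σ) (σ-injective ∘ label-injective) label∘σ-preserves u∈V' w∈V' ⟩
  dist (label u) (label w)         ≡⟨ dist-label u w ⟩
  fromℕ (distℕ u w)                ∎)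
  where
  open ≡-Reasoning
  dist-label : ∀ x y → dist (label x) (label y) ≡ fromℕ (distℕ x y)
  dist-label x y = dist-fromℕ (toℕ x) (toℕ y)
  label∘σ-preserves : EdgePreserving label _ (label ∘ σ)
  label∘σ-preserves {x} {y} xy∈E =
    trans (dist-label (σ x) (σ y)) (trans (cong fromℕ (σ-preserves xy∈E)) (sym (dist-label x y)))

-- b ∷ᵇ i = b * n + i: on Fin (2 ^ suc N), b is the leading binary digit.
infixr 5 _∷ᵇ_

_∷ᵇ_ : ∀ {n} → Fin 2 → Fin n → Fin (2 * n)
_∷ᵇ_ = combine

data Halves (N : ℕ) : Fin (2 ^ suc N) → Set where
  half : ∀ b (i : Fin (2 ^ N)) → Halves N (b ∷ᵇ i)

halves : ∀ N x → Halves N x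
halves N x with b , i , refl ← combine-surjective {2} {2 ^ N} x = half b i

toℕ-0F∷ᵇ : ∀ {n} (i : Fin n) → toℕ (0F ∷ᵇ i) ≡ toℕ i
toℕ-0F∷ᵇ i = toℕ-↑ˡ i _

toℕ-1F∷ᵇ : ∀ {n} (i : Fin n) → toℕ (1F ∷ᵇ i) ≡ n + toℕ i
toℕ-1F∷ᵇ {n} i = trans (toℕ-↑ʳ n _) (cong (n +_) (toℕ-↑ˡ i 0))

distℕ-∷ᵇ : ∀ {n} b (i k : Fin n) → distℕ (b ∷ᵇ i) (b ∷ᵇ k) ≡ distℕ i k
distℕ-∷ᵇ {n} b i k =
  trans (cong₂ ∣_-_∣ (toℕ-combine b i) (toℕ-combine b k)) (∣m+n-m+o∣≡∣n-o∣ (n * toℕ b) (toℕ i) (toℕ k))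

distℕ-rung : ∀ {n} (i : Fin n) → distℕ (0F ∷ᵇ i) (1F ∷ᵇ i) ≡ n
distℕ-rung {n} i =
  trans (cong₂ ∣_-_∣ (toℕ-0F∷ᵇ i) (trans (toℕ-1F∷ᵇ i) (+-comm n (toℕ i)))) (∣m-m+n∣≡n (toℕ i) n)

flipTop : ∀ N → Fin (2 ^ suc N) → Fin (2 ^ suc N)
flipTop N = uncurry (λ b i → opposite b ∷ᵇ i) ∘ remQuot (2 ^ N)

-- Bits are indexed from the most significant one: flipBit zero is flipTop.
flipBit : ∀ {N} → Fin N → Fin (2 ^ N) → Fin (2 ^ N)
flipBit {suc N} zero    = flipTop N
flipBit {suc N} (suc j) = uncurry (λ b i → b ∷ᵇ flipBit j i) ∘ remQuot (2 ^ N)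

flipTop-∷ᵇ : ∀ N b (i : Fin (2 ^ N)) → flipTop N (b ∷ᵇ i) ≡ opposite b ∷ᵇ i
flipTop-∷ᵇ N b i = cong (uncurry (λ b i → opposite b ∷ᵇ i)) (remQuot-combine b i)

flipBit-suc-∷ᵇ : ∀ {N} (j : Fin N) b i → flipBit (suc j) (b ∷ᵇ i) ≡ b ∷ᵇ flipBit j i
flipBit-suc-∷ᵇ j b i = cong (uncurry (λ b i → b ∷ᵇ flipBit j i)) (remQuot-combine b i)

flipBit-involutive : ∀ {N} (j : Fin N) → Involutive _≡_ (flipBit j)
flipBit-involutive {suc N} zero x with half b i ← halves N x =
  trans (cong (flipTop N) (flipTop-∷ᵇ N b i))
        (trans (flipTop-∷ᵇ N (opposite b) i) (cong (_∷ᵇ i) (opposite-involutive b)))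
flipBit-involutive {suc N} (suc j) x with half b i ← halves N x = begin
  flipBit (suc j) (flipBit (suc j) (b ∷ᵇ i)) ≡⟨ cong (flipBit (suc j)) (flipBit-suc-∷ᵇ j b i) ⟩
  flipBit (suc j) (b ∷ᵇ flipBit j i)         ≡⟨ flipBit-suc-∷ᵇ j b (flipBit j i) ⟩
  b ∷ᵇ flipBit j (flipBit j i)               ≡⟨ cong (b ∷ᵇ_) (flipBit-involutive j i) ⟩
  b ∷ᵇ i                                     ∎
  where open ≡-Reasoning

flipBit-injective : ∀ {N} (j : Fin N) → Injective _≡_ _≡_ (flipBit j)
flipBit-injective j {x} {y} eq =
  trans (sym (flipBit-involutive j x)) (trans (cong (flipBit j) eq) (flipBit-involutive j y))

flipTop-preserves-half : ∀ N b (i k : Fin (2 ^ N)) → PreservesDist (flipTop N) (b ∷ᵇ i) (b ∷ᵇ k)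
flipTop-preserves-half N b i k = begin
  distℕ (flipTop N (b ∷ᵇ i)) (flipTop N (b ∷ᵇ k)) ≡⟨ cong₂ distℕ (flipTop-∷ᵇ N b i) (flipTop-∷ᵇ N b k) ⟩
  distℕ (opposite b ∷ᵇ i) (opposite b ∷ᵇ k)         ≡⟨ distℕ-∷ᵇ (opposite b) i k ⟩
  distℕ i k                                         ≡⟨ distℕ-∷ᵇ b i k ⟨
  distℕ (b ∷ᵇ i) (b ∷ᵇ k)                           ∎
  where open ≡-Reasoning

flipBit-suc-preserves-half : ∀ {N} (j : Fin N) b (i k : Fin (2 ^ N)) →
  PreservesDist (flipBit (suc j)) (b ∷ᵇ i) (b ∷ᵇ k) ⇔ PreservesDist (flipBit j) i k
flipBit-suc-preserves-half j b i k =
  mk⇔ (subst₂ _≡_ flipped (distℕ-∷ᵇ b i k)) (subst₂ _≡_ (sym flipped) (sym (distℕ-∷ᵇ b i k)))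
  where
  flipped : distℕ (flipBit (suc j) (b ∷ᵇ i)) (flipBit (suc j) (b ∷ᵇ k)) ≡ distℕ (flipBit j i) (flipBit j k)
  flipped = trans (cong₂ distℕ (flipBit-suc-∷ᵇ j b i) (flipBit-suc-∷ᵇ j b k)) (distℕ-∷ᵇ b (flipBit j i) (flipBit j k))

flipTop-preserves⇒≡ : ∀ N {a c : Fin (2 ^ N)} → PreservesDist (flipTop N) (0F ∷ᵇ a) (1F ∷ᵇ c) → a ≡ c
flipTop-preserves⇒≡ N {a} {c} preserves =
  toℕ-injective (∣n+m-o∣≡∣n+o-m∣⇒m≡o (<⇒≤ (toℕ<n a)) (<⇒≤ (toℕ<n c)) (begin
    ∣ 2 ^ N + toℕ a - toℕ c ∣                         ≡⟨ cong₂ ∣_-_∣ (toℕ-1F∷ᵇ a) (toℕ-0F∷ᵇ c) ⟨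
    distℕ (1F ∷ᵇ a) (0F ∷ᵇ c)                         ≡⟨ cong₂ distℕ (flipTop-∷ᵇ N 0F a) (flipTop-∷ᵇ N 1F c) ⟨
    distℕ (flipTop N (0F ∷ᵇ a)) (flipTop N (1F ∷ᵇ c)) ≡⟨ preserves ⟩
    distℕ (0F ∷ᵇ a) (1F ∷ᵇ c)                         ≡⟨ ∣-∣-comm (toℕ (0F ∷ᵇ a)) _ ⟩
    distℕ (1F ∷ᵇ c) (0F ∷ᵇ a)                         ≡⟨ cong₂ ∣_-_∣ (toℕ-1F∷ᵇ c) (toℕ-0F∷ᵇ a) ⟩
    ∣ 2 ^ N + toℕ c - toℕ a ∣                         ∎))
  where open ≡-Reasoning

Edge : ℕ → Set
Edge n = Fin n × Fin n

liftEdge : ∀ {n} → Fin 2 → Edge n → Edge (2 * n)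
liftEdge b (i , k) = b ∷ᵇ i , b ∷ᵇ k

rung : ∀ {n} → Fin n → Edge (2 * n)
rung i = 0F ∷ᵇ i , 1F ∷ᵇ i

cubeEdges : ∀ N → List (Edge (2 ^ N))
cubeEdges zero    = []
cubeEdges (suc N) = cartesianProductWith liftEdge (allFin 2) (cubeEdges N) ++ map rung (allFin (2 ^ N))

data CubeEdge (N : ℕ) : Edge (2 ^ suc N) → Set where
  inHalf : ∀ b {e} → e ∈ cubeEdges N → CubeEdge N (liftEdge b e)
  across : (i : Fin (2 ^ N)) → CubeEdge N (rung i)

cubeEdge : ∀ N {e} → e ∈ cubeEdges (suc N) → CubeEdge N e
cubeEdge N e∈ with ∈-++⁻ (cartesianProductWith liftEdge (allFin 2) (cubeEdges N)) e∈
... | inj₁ e∈lifted with b , _ , _ , e∈ , refl ← ∈-cartesianProductWith⁻ liftEdge (allFin 2) (cubeEdges N) e∈lifted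
  = inHalf b e∈
... | inj₂ e∈rungs with i , _ , refl ← ∈-map⁻ rung e∈rungs = across i

cubeEdge-ascending : ∀ N {x y} → (x , y) ∈ cubeEdges N → x Fin.< y
cubeEdge-ascending (suc N) xy∈ with cubeEdge N xy∈
... | inHalf b {i , k} ik∈ = subst₂ ℕ._<_ (sym (toℕ-combine b i)) (sym (toℕ-combine b k))
                                          (+-monoʳ-< (2 ^ N * toℕ b) (cubeEdge-ascending N ik∈))
... | across i = combine-monoˡ-< {m = 2} {i = 0F} {1F} i i (s≤s ℕ.z≤n)

cubeEdges-ascending : ∀ N → All (uncurry Fin._<_) (cubeEdges N)
cubeEdges-ascending N = All.tabulate (cubeEdge-ascending N)

liftEdge-injective : ∀ {n b b′} {e e′ : Edge n} → liftEdge b e ≡ liftEdge b′ e′ → b ≡ b′ × e ≡ e′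
liftEdge-injective {_} {b} {b′} {i , k} {i′ , k′} eq
  with refl , refl ← combine-injective b i b′ i′ (cong proj₁ eq)
     | refl ← combine-injectiveʳ b k b′ k′ (cong proj₂ eq) = refl , refl

liftEdge≢rung : ∀ {n} b (e : Edge n) i → liftEdge b e ≢ rung i
liftEdge≢rung b (i , k) i′ eq
  with refl ← combine-injectiveˡ b i 0F i′ (cong proj₁ eq) | () ← combine-injectiveˡ b k 1F i′ (cong proj₂ eq)

cubeEdges-unique : ∀ N → Unique (cubeEdges N)
cubeEdges-unique zero    = []
cubeEdges-unique (suc N) =
  Unique.++⁺ (Unique.cartesianProductWith⁺ liftEdge liftEdge-injective (Unique.allFin⁺ 2) (cubeEdges-unique N))
             (Unique.map⁺ (λ {i} {i′} eq → combine-injectiveʳ {2} 0F i 0F i′ (cong proj₁ eq)) (Unique.allFin⁺ (2 ^ N)))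
             lifted-disjoint-rungs
  where
  lifted-disjoint-rungs : Disjoint (cartesianProductWith liftEdge (allFin 2) (cubeEdges N)) (map rung (allFin (2 ^ N)))
  lifted-disjoint-rungs (v∈lifted , v∈rungs)
    with b , e , _ , _ , refl ← ∈-cartesianProductWith⁻ liftEdge (allFin 2) (cubeEdges N) v∈lifted
       | i , _ , eq ← ∈-map⁻ rung v∈rungs = liftEdge≢rung b e i eq

length-cubeEdges : ∀ N → length (cubeEdges (suc N)) ≡ suc N * 2 ^ N
length-cubeEdges zero    = refl
length-cubeEdges (suc N) = begin
  length (lifted ++ rungs)                   ≡⟨ length-++ lifted ⟩
  length lifted + length rungs               ≡⟨ cong₂ _+_ length-lifted length-rungs ⟩
  2 * length (cubeEdges (suc N)) + 2 ^ suc N ≡⟨ cong (λ l → 2 * l + 2 ^ suc N) (length-cubeEdges N) ⟩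
  2 * (suc N * 2 ^ N) + 2 * 2 ^ N            ≡⟨ double-step N (2 ^ N) ⟩
  suc (suc N) * 2 ^ suc N                    ∎
  where
  open ≡-Reasoning
  lifted rungs : List (Edge (2 ^ suc (suc N)))
  lifted = cartesianProductWith liftEdge (allFin 2) (cubeEdges (suc N))
  rungs  = map rung (allFin (2 ^ suc N))
  length-lifted : length lifted ≡ 2 * length (cubeEdges (suc N))
  length-lifted = length-cartesianProductWith liftEdge (allFin 2) (cubeEdges (suc N))
  length-rungs : length rungs ≡ 2 ^ suc N
  length-rungs = trans (length-map rung (allFin (2 ^ suc N))) (length-tabulate id)
  double-step : ∀ n p → 2 * (suc n * p) + 2 * p ≡ suc (suc n) * (2 * p)
  double-step = solve-∀

flipBit-preserves-cubeEdges : ∀ {N} (j : Fin N) {x y} → (x , y) ∈ cubeEdges N → PreservesDist (flipBit j) x y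
flipBit-preserves-cubeEdges {suc N} j xy∈ with cubeEdge N xy∈
flipBit-preserves-cubeEdges {suc N} zero    _ | inHalf b {i , k} _ = flipTop-preserves-half N b i k
flipBit-preserves-cubeEdges {suc N} (suc j) _ | inHalf b {i , k} ik∈ =
  Equivalence.from (flipBit-suc-preserves-half j b i k) (flipBit-preserves-cubeEdges j ik∈)
flipBit-preserves-cubeEdges {suc N} zero    _ | across i =
  trans (cong₂ distℕ (flipTop-∷ᵇ N 0F i) (flipTop-∷ᵇ N 1F i)) (∣-∣-comm (toℕ (1F ∷ᵇ i)) _)
flipBit-preserves-cubeEdges {suc N} (suc j) _ | across i =
  trans (cong₂ distℕ (flipBit-suc-∷ᵇ j 0F i) (flipBit-suc-∷ᵇ j 1F i)) (trans (distℕ-rung (flipBit j i)) (sym (distℕ-rung i)))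

FlipRigid : ∀ N → (Fin (2 ^ N) → Set) → Set
FlipRigid N P = ∀ (j : Fin N) {x y} → P x → P y → PreservesDist (flipBit j) x y

flipRigid-half : ∀ {N P} → FlipRigid (suc N) P → ∀ b → FlipRigid N (P ∘ (b ∷ᵇ_))
flipRigid-half rigid b j {i} {k} pi pk = Equivalence.to (flipBit-suc-preserves-half j b i k) (rigid (suc j) pi pk)

flipRigid-collapse : ∀ {N P} → FlipRigid (suc N) P → ∀ b b′ → b ≢ b′ → ∀ (i k c : Fin (2 ^ N)) →
                     P (b ∷ᵇ i) → P (b ∷ᵇ k) → P (b′ ∷ᵇ c) → b ∷ᵇ i ≡ b ∷ᵇ k
flipRigid-collapse {N} rigid 0F 1F _ i k c pi pk pc =
  cong (0F ∷ᵇ_) (trans (flipTop-preserves⇒≡ N (rigid zero pi pc)) (sym (flipTop-preserves⇒≡ N (rigid zero pk pc))))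
flipRigid-collapse {N} rigid 1F 0F _ i k c pi pk pc =
  cong (1F ∷ᵇ_) (trans (sym (flipTop-preserves⇒≡ N (rigid zero pc pi))) (flipTop-preserves⇒≡ N (rigid zero pc pk)))
flipRigid-collapse rigid 0F 0F b≢b′ = ⊥-elim (b≢b′ refl)
flipRigid-collapse rigid 1F 1F b≢b′ = ⊥-elim (b≢b′ refl)

flipRigid⇒¬3distinct : ∀ N {P} → FlipRigid N P → ∀ {x y z} → P x → P y → P z → x ≢ y → y ≢ z → x ≢ z → ⊥
flipRigid⇒¬3distinct zero    _ {0F} {0F} _ _ _ x≢y _ _ = x≢y refl
flipRigid⇒¬3distinct (suc N) rigid {x} {y} {z} px py pz x≢y y≢z x≢z
  with halves N x | halves N y | halves N z
... | half 0F a | half 0F b | half 0F c = flipRigid⇒¬3distinct N (flipRigid-half rigid 0F) {a} {b} {c} px py pz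
                                            (x≢y ∘ cong (0F ∷ᵇ_)) (y≢z ∘ cong (0F ∷ᵇ_)) (x≢z ∘ cong (0F ∷ᵇ_))
... | half 1F a | half 1F b | half 1F c = flipRigid⇒¬3distinct N (flipRigid-half rigid 1F) {a} {b} {c} px py pz
                                            (x≢y ∘ cong (1F ∷ᵇ_)) (y≢z ∘ cong (1F ∷ᵇ_)) (x≢z ∘ cong (1F ∷ᵇ_))
... | half 0F a | half 0F b | half 1F c = x≢y (flipRigid-collapse rigid 0F 1F (λ ()) a b c px py pz)
... | half 1F a | half 1F b | half 0F c = x≢y (flipRigid-collapse rigid 1F 0F (λ ()) a b c px py pz)
... | half 0F a | half 1F b | half 0F c = x≢z (flipRigid-collapse rigid 0F 1F (λ ()) a c b px pz py)
... | half 1F a | half 0F b | half 1F c = x≢z (flipRigid-collapse rigid 1F 0F (λ ()) a c b px pz py)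
... | half 1F a | half 0F b | half 0F c = y≢z (flipRigid-collapse rigid 0F 1F (λ ()) b c a py pz px)
... | half 0F a | half 1F b | half 1F c = y≢z (flipRigid-collapse rigid 1F 0F (λ ()) b c a py pz px)

theorem1p4 : (N : ℕ) → 1 ≤ N →
    Σ (Fin (2 ^ N) → ℚ) λ v → Injective _≡_ _≡_ v ×
    Σ (List (Fin (2 ^ N) × Fin (2 ^ N))) λ E → SimpleEdges E × length E ≡ N * 2 ^ (N ∸ 1) ×
    ((V' : Subset (2 ^ N)) → 2 < ∣ V' ∣ → ¬ Reconstructible v E V')
theorem1p4 zero    ()
theorem1p4 (suc N) _ =
  label , label-injective , cubeEdges (suc N) , (cubeEdges-ascending (suc N) , cubeEdges-unique (suc N)) ,
  length-cubeEdges N , no-reconstructible-triple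
  where
  no-reconstructible-triple : (V' : Subset (2 ^ suc N)) → 2 < ∣ V' ∣ → ¬ Reconstructible label (cubeEdges (suc N)) V'
  no-reconstructible-triple V' 3≤∣V'∣ R with p , p-injective , p∈V' ← enumerate V' 3≤∣V'∣ =
    flipRigid⇒¬3distinct (suc N) rigid (p∈V' 0F) (p∈V' 1F) (p∈V' 2F)
      ((λ ()) ∘ p-injective) ((λ ()) ∘ p-injective) ((λ ()) ∘ p-injective)
    where
    rigid : FlipRigid (suc N) (Subset._∈ V')
    rigid j = reconstructible⇒preserved R (flipBit j) (flipBit-injective j) (flipBit-preserves-cubeEdges j)
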